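{- For integers $i\ge0$, $j\ge0$: (a) for every real $k$, $\sum_{r=j}^{i}c_{i,r,k}\,b_{r,j,k}=j!\,\delta_{i,j}$; (b) for integers $k_1,k_2$ with $k_2\ge k_1$, $\sum_{r=j}^{i}c_{i,r,k_1}\,b_{r,j,k_2}=i!\binom{k_2-k_1}{i-j}$.
   Context: The signed Stirling numbers of the first kind $s_{i,r}$ are defined by $x(x-1)\cdots(x-i+1)=\sum_{r=0}^{i}s_{i,r}x^r$. For integers $i,j\ge0$ and real $k$, $c_{i,j,k}=\sum_{r=j}^{i}\binom{r}{j}(-k)^{r-j}s_{i,r}$ (zero if $j>i$), and the moment generating Stirling numbers of the second kind are $b_{i,j,k}=\sum_{r=0}^{j}\binom{j}{r}(-1)^{j-r}(r+k)^i$ (with $0^0=1$). $\delta_{i,j}$ is the Kronecker delta, and $\binom{n}{m}=0$ for $m<0$ or $m>n$ (nonnegative integer $n$). An empty sum (when $j>i$) is $0$. -}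

module Defs where

open import Level using (Level)
open import Data.Nat as ℕ using (ℕ; zero; suc; _∸_; _≡ᵇ_)
open import Data.Nat.Combinatorics using (_C_)
open import Data.Bool using (if_then_else_)
open import Data.Integer as ℤ using (ℤ; +_; -[1+_])
open import Algebra.Bundles using (CommutativeRing; Semiring)

module Gen {c ℓ : Level} (R : CommutativeRing c ℓ) where
  open CommutativeRing R hiding (zero)
  open import Algebra.Definitions.RawSemiring (Semiring.rawSemiring semiring) using (_×_; _^_)

  sumN : ℕ → (ℕ → Carrier) → Carrier
  sumN zero    f = 0#
  sumN (suc n) f = sumN n f + f n

  -- Σ_{r=m}^{n} f r   (empty, i.e. 0, when m > n)
  sumFT : ℕ → ℕ → (ℕ → Carrier) → Carrier
  sumFT m n f = sumN (suc n ∸ m) (λ t → f (m ℕ.+ t))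

  -- signed Stirling numbers of the first kind, as coefficients of the
  -- falling factorial x(x-1)...(x-i+1), computed via
  -- x(x-1)...(x-i) = (x(x-1)...(x-i+1)) * (x - i)
  stirling1 : ℕ → ℕ → Carrier
  stirling1 zero    zero    = 1#
  stirling1 zero    (suc r) = 0#
  stirling1 (suc i) zero    = - (i × 1#) * stirling1 i zero
  stirling1 (suc i) (suc r) = stirling1 i r - (i × 1#) * stirling1 i (suc r)

  cc : ℕ → ℕ → Carrier → Carrier
  cc i j k = sumFT j i (λ r → (r C j) × ((- k) ^ (r ∸ j) * stirling1 i r))

  -- b_{i,j,k} = Σ_{r=0}^{j} C(j,r) (-1)^{j-r} (r+k)^i   (x^0 = 1)
  bb : ℕ → ℕ → Carrier → Carrier
  bb i j k = sumFT 0 j (λ r → (j C r) × ((- 1#) ^ (j ∸ r) * ((r × 1# + k) ^ i)))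

  δ : ℕ → ℕ → Carrier
  δ i j = if i ≡ᵇ j then 1# else 0#

  convo : ℕ → ℕ → Carrier → Carrier → Carrier
  convo i j k₁ k₂ = sumFT j i (λ r → cc i r k₁ * bb r j k₂)

  natR : ℕ → Carrier
  natR n = n × 1#

open import Data.Integer.Properties using (+-*-commutativeRing)
module GenZ = Gen +-*-commutativeRing

chooseℤ : ℕ → ℤ → ℤ
chooseℤ n (+ m)    = + (n C m)
chooseℤ n -[1+ m ] = + 0

module Submission where

-- Write b_{r,j,k} = Δʲ[t ↦ (t + k)^r](0) for the j-th forward difference Δʲ at 0.
-- Since the s_{i,r} are the coefficients of the falling factorial x↓i,
-- the binomial theorem gives Σ_r c_{i,r,k₁} y^r = (y - k₁)↓i, so by linearity of Δʲ
-- the convolution is Δʲ[t ↦ (t + k₂ - k₁)↓i](0).  As Δ (x↓i) = i · x↓(i-1), this is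
-- i(i-1)⋯(i-j+1) · m↓(i-j) with m = k₂ - k₁: for m = 0 it is j! δ_{i,j}, and for
-- m ∈ ℕ it is i! C(m, i-j).  Extending the convolution to the terms r < j adds nothing,
-- because Δʲ annihilates polynomials of degree below j.

open import Algebra.Bundles using (CommutativeRing; Semiring)
open import Algebra.Solver.Ring.AlmostCommutativeRing
  using (fromCommutativeRing; _-Raw-AlmostCommutative⟶_)
open import Data.Nat as ℕ using (ℕ; zero; suc; _∸_; s≤s; _!)
import Data.Nat.Properties as ℕP
open import Data.Nat.Combinatorics using (_C_; k>n⇒nCk≡0; nCk+nC[k+1]≡[n+1]C[k+1])
open import Data.Integer as ℤ using (ℤ; +_; -[1+_]; _⊖_)
import Data.Integer.Properties as ℤP
open import Data.Maybe using (Maybe; just; nothing)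
open import Data.Sign as Sign using ()
open import Data.Sum using (_⊎_; inj₁; inj₂)
open import Function using (_∘_)
open import Relation.Binary.PropositionalEquality as ≡ using (_≡_)
open import Relation.Nullary using (yes; no)
open import Defs

-- Every commutative ring is a ℤ-algebra, which lets the ring solver use integer constants.
module IntegerCoefficients {c ℓ} (R : CommutativeRing c ℓ) where
  open import Data.Nat using (_≤_)
  open CommutativeRing R
  open import Algebra.Properties.Ring ring
    using (-0#≈0#; -‿involutive; ⁻¹-anti-homo‿-; x≈z//y; -‿distribˡ-*; -‿distribʳ-*; -‿+-comm)
  open import Algebra.Properties.Semiring.Mult.TCOptimised semiring using (_×_; ×-homo-+; ×1-homo-*)
  open import Relation.Binary.Reasoning.Setoid setoid

  fromℤ : ℤ → Carrier
  fromℤ (+ n)    = n × 1#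
  fromℤ -[1+ n ] = - (suc n × 1#)

  fromℤ-neg : ∀ z → fromℤ (ℤ.- z) ≈ - fromℤ z
  fromℤ-neg (+ zero)  = sym -0#≈0#
  fromℤ-neg (+ suc n) = refl
  fromℤ-neg -[1+ n ]  = sym (-‿involutive _)

  ∸-×1 : ∀ {m n} → n ≤ m → (m ∸ n) × 1# ≈ m × 1# - n × 1#
  ∸-×1 {m} {n} n≤m = x≈z//y _ _ _ (begin
    (m ∸ n) × 1# + n × 1#  ≈⟨ ×-homo-+ 1# (m ∸ n) n ⟨
    (m ∸ n ℕ.+ n) × 1#     ≡⟨ ≡.cong (_× 1#) (ℕP.m∸n+n≡m n≤m) ⟩
    m × 1#                 ∎)

  fromℤ-⊖ : ∀ m n → fromℤ (m ⊖ n) ≈ m × 1# - n × 1#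
  fromℤ-⊖ m n with ℕP.≤-<-connex n m
  ... | inj₁ n≤m = begin
    fromℤ (m ⊖ n)  ≡⟨ ≡.cong fromℤ (ℤP.⊖-≥ n≤m) ⟩
    (m ∸ n) × 1#   ≈⟨ ∸-×1 n≤m ⟩
    m × 1# - n × 1# ∎
  ... | inj₂ m<n = begin
    fromℤ (m ⊖ n)            ≡⟨ ≡.cong fromℤ (ℤP.⊖-< m<n) ⟩
    fromℤ (ℤ.- (+ (n ∸ m)))  ≈⟨ fromℤ-neg (+ (n ∸ m)) ⟩
    - ((n ∸ m) × 1#)         ≈⟨ -‿cong (∸-×1 (ℕP.<⇒≤ m<n)) ⟩
    - (n × 1# - m × 1#)      ≈⟨ ⁻¹-anti-homo‿- _ _ ⟩
    m × 1# - n × 1#          ∎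

  fromℤ-+ : ∀ a b → fromℤ (a ℤ.+ b) ≈ fromℤ a + fromℤ b
  fromℤ-+ (+ m)    (+ n)    = ×-homo-+ 1# m n
  fromℤ-+ (+ m)    -[1+ n ] = fromℤ-⊖ m (suc n)
  fromℤ-+ -[1+ m ] (+ n)    = trans (fromℤ-⊖ n (suc m)) (+-comm _ _)
  fromℤ-+ -[1+ m ] -[1+ n ] = begin
    - (suc (suc (m ℕ.+ n)) × 1#)     ≡⟨ ≡.cong (λ k → - (suc k × 1#)) (ℕP.+-suc m n) ⟨
    - ((suc m ℕ.+ suc n) × 1#)       ≈⟨ -‿cong (×-homo-+ 1# (suc m) (suc n)) ⟩
    - (suc m × 1# + suc n × 1#)      ≈⟨ -‿+-comm _ _ ⟨
    - (suc m × 1#) + - (suc n × 1#)  ∎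

  fromℤ-+◃ : ∀ n → fromℤ (Sign.+ ℤ.◃ n) ≈ n × 1#
  fromℤ-+◃ n = ≡.subst (λ z → fromℤ z ≈ n × 1#) (≡.sym (ℤP.+◃n≡+n n)) refl

  fromℤ--◃ : ∀ n → fromℤ (Sign.- ℤ.◃ n) ≈ - (n × 1#)
  fromℤ--◃ n = ≡.subst (λ z → fromℤ z ≈ - (n × 1#)) (≡.sym (ℤP.-◃n≡-n n)) (fromℤ-neg (+ n))

  fromℤ-* : ∀ a b → fromℤ (a ℤ.* b) ≈ fromℤ a * fromℤ b
  fromℤ-* (+ m) (+ n) = trans (fromℤ-+◃ (m ℕ.* n)) (×1-homo-* m n)
  fromℤ-* (+ m) -[1+ n ] = begin
    fromℤ (Sign.- ℤ.◃ (m ℕ.* suc n))  ≈⟨ fromℤ--◃ (m ℕ.* suc n) ⟩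
    - ((m ℕ.* suc n) × 1#)            ≈⟨ -‿cong (×1-homo-* m (suc n)) ⟩
    - (m × 1# * suc n × 1#)           ≈⟨ -‿distribʳ-* _ _ ⟩
    m × 1# * - (suc n × 1#)           ∎
  fromℤ-* -[1+ m ] (+ n) = begin
    fromℤ (Sign.- ℤ.◃ (suc m ℕ.* n))  ≈⟨ fromℤ--◃ (suc m ℕ.* n) ⟩
    - ((suc m ℕ.* n) × 1#)            ≈⟨ -‿cong (×1-homo-* (suc m) n) ⟩
    - (suc m × 1# * n × 1#)           ≈⟨ -‿distribˡ-* _ _ ⟩
    - (suc m × 1#) * n × 1#           ∎
  fromℤ-* -[1+ m ] -[1+ n ] = begin
    fromℤ (Sign.+ ℤ.◃ (suc m ℕ.* suc n))  ≈⟨ fromℤ-+◃ (suc m ℕ.* suc n) ⟩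
    (suc m ℕ.* suc n) × 1#                ≈⟨ ×1-homo-* (suc m) (suc n) ⟩
    suc m × 1# * suc n × 1#               ≈⟨ -‿involutive _ ⟨
    - - (suc m × 1# * suc n × 1#)         ≈⟨ -‿cong (-‿distribˡ-* _ _) ⟩
    - (- (suc m × 1#) * suc n × 1#)       ≈⟨ -‿distribʳ-* _ _ ⟩
    - (suc m × 1#) * - (suc n × 1#)       ∎

  fromℤ-homomorphism : ℤ.+-*-rawRing -Raw-AlmostCommutative⟶ fromCommutativeRing R
  fromℤ-homomorphism = record
    { ⟦_⟧ = fromℤ ; +-homo = fromℤ-+ ; *-homo = fromℤ-* ; -‿homo = fromℤ-neg
    ; 0-homo = refl ; 1-homo = refl }

  fromℤ-≟ : ∀ a b → Maybe (fromℤ a ≈ fromℤ b)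
  fromℤ-≟ a b with a ℤ.≟ b
  ... | yes ≡.refl = just refl
  ... | no _       = nothing

  open import Algebra.Solver.Ring ℤ.+-*-rawRing (fromCommutativeRing R) fromℤ-homomorphism fromℤ-≟ public

!*C-pascal : ∀ n d → (suc d !) ℕ.* (n C suc d) ℕ.+ suc d ℕ.* ((d !) ℕ.* (n C d))
                    ≡ (suc d !) ℕ.* (suc n C suc d)
!*C-pascal n d = ≡.sym (begin
  (suc d !) ℕ.* (suc n C suc d)                  ≡⟨ ≡.cong ((suc d !) ℕ.*_) (nCk+nC[k+1]≡[n+1]C[k+1] n d) ⟨
  (suc d !) ℕ.* (n C d ℕ.+ n C suc d)            ≡⟨ ℕP.*-distribˡ-+ (suc d !) (n C d) (n C suc d) ⟩
  (suc d !) ℕ.* (n C d) ℕ.+ a                     ≡⟨ ≡.cong (ℕ._+ a) (ℕP.*-assoc (suc d) (d !) (n C d)) ⟩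
  suc d ℕ.* ((d !) ℕ.* (n C d)) ℕ.+ a             ≡⟨ ℕP.+-comm _ a ⟩
  a ℕ.+ suc d ℕ.* ((d !) ℕ.* (n C d))             ∎)
  where
  open ≡.≡-Reasoning
  a = (suc d !) ℕ.* (n C suc d)

module StirlingConvolution {c ℓ} (R : CommutativeRing c ℓ) where
  open import Data.Nat using (_<_; _≤_)
  open CommutativeRing R hiding (zero)
  open Gen R
  open import Algebra.Definitions.RawSemiring (Semiring.rawSemiring semiring) using (_×_; _^_)
  open import Algebra.Properties.Ring ring using (-0#≈0#; -‿+-comm; -1*x≈-x)
  open import Algebra.Properties.Semiring.Mult semiring using (×-homo-+; ×1-homo-*; ×-comm-*; ×-assoc-*; ×-congˡ; ×-congʳ)
  open import Algebra.Properties.CommutativeMonoid.Mult +-commutativeMonoid using (×-distrib-+)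
  open import Algebra.Properties.Semiring.Exp semiring using (^-congˡ)
  open import Algebra.Properties.CommutativeSemigroup +-commutativeSemigroup
    using (interchange; xy∙z≈y∙xz)
  open import Algebra.Properties.CommutativeSemigroup *-commutativeSemigroup
    using (x∙yz≈y∙xz)
  open import Relation.Binary.Reasoning.Setoid setoid
  open IntegerCoefficients R using (solve; _:+_; _:*_; _:-_; :-_; _:=_; con)

  -- Finite sums

  sumN-cong-< : ∀ n {f g : ℕ → Carrier} → (∀ t → t < n → f t ≈ g t) → sumN n f ≈ sumN n g
  sumN-cong-< zero    f≈g = refl
  sumN-cong-< (suc n) f≈g =
    +-cong (sumN-cong-< n (λ t t<n → f≈g t (ℕP.m<n⇒m<1+n t<n))) (f≈g n ℕP.≤-refl)

  sumN-cong : ∀ n {f g : ℕ → Carrier} → (∀ t → f t ≈ g t) → sumN n f ≈ sumN n g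
  sumN-cong n f≈g = sumN-cong-< n (λ t _ → f≈g t)

  sumN-zero : ∀ n {f : ℕ → Carrier} → (∀ t → t < n → f t ≈ 0#) → sumN n f ≈ 0#
  sumN-zero zero    f≈0 = refl
  sumN-zero (suc n) f≈0 = trans
    (+-cong (sumN-zero n (λ t t<n → f≈0 t (ℕP.m<n⇒m<1+n t<n))) (f≈0 n ℕP.≤-refl))
    (+-identityʳ 0#)

  sumN-+ : ∀ n (f g : ℕ → Carrier) → sumN n (λ t → f t + g t) ≈ sumN n f + sumN n g
  sumN-+ zero    f g = sym (+-identityʳ 0#)
  sumN-+ (suc n) f g = trans (+-congʳ (sumN-+ n f g)) (interchange _ _ _ _)

  sumN-neg : ∀ n (f : ℕ → Carrier) → sumN n (λ t → - f t) ≈ - sumN n f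
  sumN-neg zero    f = sym -0#≈0#
  sumN-neg (suc n) f = trans (+-congʳ (sumN-neg n f)) (-‿+-comm _ _)

  sumN-*ˡ : ∀ n a (f : ℕ → Carrier) → a * sumN n f ≈ sumN n (λ t → a * f t)
  sumN-*ˡ zero    a f = zeroʳ a
  sumN-*ˡ (suc n) a f = trans (distribˡ a _ _) (+-congʳ (sumN-*ˡ n a f))

  sumN-*ʳ : ∀ n a (f : ℕ → Carrier) → sumN n f * a ≈ sumN n (λ t → f t * a)
  sumN-*ʳ n a f = trans (*-comm _ a) (trans (sumN-*ˡ n a f) (sumN-cong n (λ t → *-comm a (f t))))

  sumN-split : ∀ m n (f : ℕ → Carrier) → sumN (m ℕ.+ n) f ≈ sumN m f + sumN n (λ t → f (m ℕ.+ t))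
  sumN-split m zero f = begin
    sumN (m ℕ.+ 0) f  ≡⟨ ≡.cong (λ k → sumN k f) (ℕP.+-identityʳ m) ⟩
    sumN m f          ≈⟨ +-identityʳ _ ⟨
    sumN m f + 0#     ∎
  sumN-split m (suc n) f = begin
    sumN (m ℕ.+ suc n) f                                     ≡⟨ ≡.cong (λ k → sumN k f) (ℕP.+-suc m n) ⟩
    sumN (m ℕ.+ n) f + f (m ℕ.+ n)                           ≈⟨ +-congʳ (sumN-split m n f) ⟩
    (sumN m f + sumN n (λ t → f (m ℕ.+ t))) + f (m ℕ.+ n)    ≈⟨ +-assoc _ _ _ ⟩
    sumN m f + (sumN n (λ t → f (m ℕ.+ t)) + f (m ℕ.+ n))    ∎

  sumN-suc : ∀ n (f : ℕ → Carrier) → sumN (suc n) f ≈ f 0 + sumN n (f ∘ suc)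
  sumN-suc n f = trans (sumN-split 1 n f) (+-congʳ (+-identityˡ (f 0)))

  sumN-extend : ∀ {n N} (f : ℕ → Carrier) → n ≤ N → (∀ t → n ≤ t → f t ≈ 0#) → sumN N f ≈ sumN n f
  sumN-extend {n} {N} f n≤N f≈0 = begin
    sumN N f                                         ≡⟨ ≡.cong (λ k → sumN k f) (ℕP.m+[n∸m]≡n n≤N) ⟨
    sumN (n ℕ.+ (N ∸ n)) f                           ≈⟨ sumN-split n (N ∸ n) f ⟩
    sumN n f + sumN (N ∸ n) (λ t → f (n ℕ.+ t))
      ≈⟨ +-congˡ (sumN-zero (N ∸ n) (λ t _ → f≈0 (n ℕ.+ t) (ℕP.m≤m+n n t))) ⟩
    sumN n f + 0#                                    ≈⟨ +-identityʳ _ ⟩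
    sumN n f                                         ∎

  sumFT≈sumN : ∀ m n (f : ℕ → Carrier) → (∀ t → t < m → f t ≈ 0#) → sumFT m n f ≈ sumN (suc n) f
  sumFT≈sumN m n f f≈0 with ℕP.≤-<-connex m (suc n)
  ... | inj₁ m≤1+n = sym (begin
    sumN (suc n) f                ≡⟨ ≡.cong (λ k → sumN k f) (ℕP.m+[n∸m]≡n m≤1+n) ⟨
    sumN (m ℕ.+ (suc n ∸ m)) f    ≈⟨ sumN-split m _ f ⟩
    sumN m f + sumFT m n f        ≈⟨ +-congʳ (sumN-zero m f≈0) ⟩
    0# + sumFT m n f              ≈⟨ +-identityˡ _ ⟩
    sumFT m n f                   ∎)
  ... | inj₂ 1+n<m = begin
    sumFT m n f     ≡⟨ ≡.cong (λ k → sumN k (λ t → f (m ℕ.+ t))) (ℕP.m≤n⇒m∸n≡0 (ℕP.<⇒≤ 1+n<m)) ⟩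
    0#              ≈⟨ sumN-zero (suc n) (λ t t< → f≈0 t (ℕP.<-trans t< 1+n<m)) ⟨
    sumN (suc n) f  ∎

  sumN-swap : ∀ n m (f : ℕ → ℕ → Carrier) →
              sumN n (λ a → sumN m (λ b → f a b)) ≈ sumN m (λ b → sumN n (λ a → f a b))
  sumN-swap zero    m f = sym (sumN-zero m (λ _ _ → refl))
  sumN-swap (suc n) m f = trans (+-congʳ (sumN-swap n m f)) (sym (sumN-+ m _ _))

  binomial : ∀ n x y → (x + y) ^ n ≈ sumN (suc n) (λ r → (n C r) × (x ^ r * y ^ (n ∸ r)))
  binomial n x y = trans (theorem (*-comm x y) n) (sum≈sumN (suc n) _)
    where
    open import Algebra.Properties.Semiring.Binomial semiring x y using (theorem)
    open import Algebra.Properties.Semiring.Sum semiring using (sum)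
    open import Data.Fin using (toℕ)
    sum≈sumN : ∀ n (f : ℕ → Carrier) → sum {n} (λ i → f (toℕ i)) ≈ sumN n f
    sum≈sumN zero    f = refl
    sum≈sumN (suc n) f = trans (+-congˡ (sum≈sumN n (f ∘ suc))) (sym (sumN-suc n f))

  C>⇒×≈0 : ∀ {j r} x → j < r → (j C r) × x ≈ 0#
  C>⇒×≈0 x j<r = ≡.subst (λ k → k × x ≈ 0#) (≡.sym (k>n⇒nCk≡0 j<r)) refl

  ×≈×1* : ∀ n x → n × x ≈ (n × 1#) * x
  ×≈×1* n x = sym (trans (×-assoc-* n 1# x) (×-congʳ n (*-identityˡ x)))

  -- Forward differences

  -- Δ j g is the j-th forward difference of g at 0, so that b_{r,j,k} is
  -- definitionally Δ j (λ t → (t × 1# + k) ^ r).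
  Δterm : ℕ → (ℕ → Carrier) → ℕ → Carrier
  Δterm j g r = (j C r) × ((- 1#) ^ (j ∸ r) * g r)

  Δ : ℕ → (ℕ → Carrier) → Carrier
  Δ j g = sumN (suc j) (Δterm j g)

  Δ-cong : ∀ j {g h : ℕ → Carrier} → (∀ t → g t ≈ h t) → Δ j g ≈ Δ j h
  Δ-cong j g≈h = sumN-cong (suc j) (λ t → ×-congʳ (j C t) (*-congˡ (g≈h t)))

  Δ-+ : ∀ j (g h : ℕ → Carrier) → Δ j (λ t → g t + h t) ≈ Δ j g + Δ j h
  Δ-+ j g h = trans (sumN-cong (suc j) term-+) (sumN-+ (suc j) _ _)
    where
    term-+ : ∀ r → Δterm j (λ t → g t + h t) r ≈ Δterm j g r + Δterm j h r
    term-+ r = trans (×-congʳ (j C r) (distribˡ _ (g r) (h r))) (×-distrib-+ _ _ (j C r))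

  Δ-*ˡ : ∀ j a (g : ℕ → Carrier) → Δ j (λ t → a * g t) ≈ a * Δ j g
  Δ-*ˡ j a g = trans (sumN-cong (suc j) term-*) (sym (sumN-*ˡ (suc j) a _))
    where
    term-* : ∀ r → Δterm j (λ t → a * g t) r ≈ a * Δterm j g r
    term-* r = trans (×-congʳ (j C r) (x∙yz≈y∙xz _ a (g r))) (sym (×-comm-* (j C r) a _))

  Δ-sum : ∀ j n (a : ℕ → Carrier) (g : ℕ → ℕ → Carrier) →
          sumN n (λ r → a r * Δ j (g r)) ≈ Δ j (λ t → sumN n (λ r → a r * g r t))
  Δ-sum j zero    a g = sym (trans (Δ-cong j (λ _ → sym (zeroˡ 0#))) (trans (Δ-*ˡ j 0# (λ _ → 0#)) (zeroˡ _)))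
  Δ-sum j (suc n) a g = trans (+-cong (Δ-sum j n a g) (sym (Δ-*ˡ j (a n) (g n)))) (sym (Δ-+ j _ _))

  Δ-zero : ∀ (g : ℕ → Carrier) → Δ 0 g ≈ g 0
  Δ-zero g = trans (+-identityˡ _) (trans (+-identityʳ _) (*-identityˡ (g 0)))

  -- In the solver step Δterm (suc j) g 0 and U 0 unfold to (- 1# * (- 1#) ^ j) * g 0 + 0#
  -- and (- 1#) ^ j * g 0 + 0#.
  Δ-suc : ∀ j (g : ℕ → Carrier) → Δ (suc j) g ≈ Δ j (g ∘ suc) - Δ j g
  Δ-suc j g = begin
    Δ (suc j) g                                               ≈⟨ sumN-suc (suc j) (Δterm (suc j) g) ⟩
    Δterm (suc j) g 0 + sumN (suc j) (Δterm (suc j) g ∘ suc)  ≈⟨ +-congˡ (sumN-cong (suc j) pascal) ⟩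
    Δterm (suc j) g 0 + sumN (suc j) (λ r → A r + B r)        ≈⟨ +-congˡ (sumN-+ (suc j) A B) ⟩
    Δterm (suc j) g 0 + (Δ j (g ∘ suc) + sumN (suc j) B)      ≈⟨ +-congˡ (+-congˡ B-sum) ⟩
    Δterm (suc j) g 0 + (Δ j (g ∘ suc) - sumN j (U ∘ suc))    ≈⟨ solve 4 (λ W G DA X →
        ((con -[1+ 0 ] :* W) :* G :+ con (+ 0)) :+ (DA :- X) := DA :- ((W :* G :+ con (+ 0)) :+ X))
        refl ((- 1#) ^ j) (g 0) (Δ j (g ∘ suc)) (sumN j (U ∘ suc)) ⟩
    Δ j (g ∘ suc) - (U 0 + sumN j (U ∘ suc))                  ≈⟨ +-congˡ (-‿cong (sumN-suc j U)) ⟨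
    Δ j (g ∘ suc) - Δ j g                                     ∎
    where
    U A B : ℕ → Carrier
    U = Δterm j g
    A = Δterm j (g ∘ suc)
    B r = (j C suc r) × ((- 1#) ^ (j ∸ r) * g (suc r))
    pascal : ∀ r → Δterm (suc j) g (suc r) ≈ A r + B r
    pascal r = trans (×-congˡ (≡.sym (nCk+nC[k+1]≡[n+1]C[k+1] j r))) (×-homo-+ _ (j C r) (j C suc r))
    B≈-U : ∀ r → r < j → B r ≈ - U (suc r)
    B≈-U r r<j = begin
      (j C suc r) × ((- 1#) ^ (j ∸ r) * g (suc r))
        ≡⟨ ≡.cong (λ k → (j C suc r) × ((- 1#) ^ k * g (suc r))) (ℕP.+-∸-assoc 1 r<j) ⟩
      (j C suc r) × ((- 1# * e) * g (suc r))        ≈⟨ ×-congʳ (j C suc r) (*-assoc _ _ _) ⟩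
      (j C suc r) × (- 1# * (e * g (suc r)))        ≈⟨ ×-comm-* (j C suc r) (- 1#) _ ⟨
      - 1# * U (suc r)                              ≈⟨ -1*x≈-x _ ⟩
      - U (suc r)                                   ∎
      where e = (- 1#) ^ (j ∸ suc r)
    B-sum : sumN (suc j) B ≈ - sumN j (U ∘ suc)
    B-sum = trans (sumN-extend B (ℕP.n≤1+n j) (λ t j≤t → C>⇒×≈0 _ (s≤s j≤t)))
                  (trans (sumN-cong-< j B≈-U) (sumN-neg j (U ∘ suc)))

  Δ-const : ∀ j a → Δ (suc j) (λ _ → a) ≈ 0#
  Δ-const j a = trans (Δ-suc j (λ _ → a)) (-‿inverseʳ _)

  shift : ∀ t k → suc t × 1# + k ≈ t × 1# + (1# + k)
  shift t k = xy∙z≈y∙xz 1# (t × 1#) k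

  Δ-leibniz : ∀ j k (g : ℕ → Carrier) →
              Δ (suc j) (λ t → (t × 1# + k) * g t) ≈ k * Δ (suc j) g + (suc j × 1#) * Δ j (g ∘ suc)
  Δ-leibniz zero k g = begin
    Δ 1 h                                   ≈⟨ Δ-suc 0 h ⟩
    Δ 0 (h ∘ suc) - Δ 0 h                   ≈⟨ +-cong (Δ-zero (h ∘ suc)) (-‿cong (Δ-zero h)) ⟩
    ((1# + 0#) + k) * g 1 - (0# + k) * g 0  ≈⟨ solve 3 (λ k a b →
        ((con (+ 1) :+ con (+ 0)) :+ k) :* a :- (con (+ 0) :+ k) :* b
        := k :* (a :- b) :+ (con (+ 1) :+ con (+ 0)) :* a) refl k (g 1) (g 0) ⟩
    k * (g 1 - g 0) + (1# + 0#) * g 1       ≈⟨ +-cong (*-congˡ Δ₁g) (*-congˡ (Δ-zero (g ∘ suc))) ⟨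
    k * Δ 1 g + (1 × 1#) * Δ 0 (g ∘ suc)    ∎
    where
    h = λ t → (t × 1# + k) * g t
    Δ₁g : Δ 1 g ≈ g 1 - g 0
    Δ₁g = trans (Δ-suc 0 g) (+-cong (Δ-zero (g ∘ suc)) (-‿cong (Δ-zero g)))
  Δ-leibniz (suc j) k g = begin
    Δ (suc (suc j)) h                                            ≈⟨ Δ-suc (suc j) h ⟩
    Δ (suc j) (h ∘ suc) - Δ (suc j) h
        ≈⟨ +-congʳ (Δ-cong (suc j) (λ t → *-congʳ (shift t k))) ⟩
    Δ (suc j) (λ t → (t × 1# + (1# + k)) * g (suc t)) - Δ (suc j) h
        ≈⟨ +-cong (Δ-leibniz j (1# + k) (g ∘ suc)) (-‿cong (Δ-leibniz j k g)) ⟩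
    ((1# + k) * A + n * C₂) - (k * B + n * C₁)                   ≈⟨ +-congʳ (+-congʳ (*-congˡ A≈)) ⟩
    ((1# + k) * (C₂ - C₁) + n * C₂) - (k * B + n * C₁)           ≈⟨ solve 5 (λ k n B C₂ C₁ →
        ((con (+ 1) :+ k) :* (C₂ :- C₁) :+ n :* C₂) :- (k :* B :+ n :* C₁)
        := k :* ((C₂ :- C₁) :- B) :+ (con (+ 1) :+ n) :* (C₂ :- C₁)) refl k n B C₂ C₁ ⟩
    k * ((C₂ - C₁) - B) + (1# + n) * (C₂ - C₁)
        ≈⟨ +-cong (*-congˡ (trans (Δ-suc (suc j) g) (+-congʳ A≈))) (*-congˡ A≈) ⟨
    k * Δ (suc (suc j)) g + (suc (suc j) × 1#) * Δ (suc j) (g ∘ suc) ∎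
    where
    h = λ t → (t × 1# + k) * g t
    n = suc j × 1#
    A = Δ (suc j) (g ∘ suc)
    B = Δ (suc j) g
    C₁ = Δ j (g ∘ suc)
    C₂ = Δ j (g ∘ suc ∘ suc)
    A≈ : A ≈ C₂ - C₁
    A≈ = Δ-suc j (g ∘ suc)

  Δ-pow-< : ∀ {r j} → r < j → ∀ k → Δ j (λ t → (t × 1# + k) ^ r) ≈ 0#
  Δ-pow-< {zero}  {suc j} _          k = Δ-const j 1#
  Δ-pow-< {suc r} {suc j} (s≤s r<j) k = begin
    Δ (suc j) (λ t → (t × 1# + k) * (t × 1# + k) ^ r)  ≈⟨ Δ-leibniz j k _ ⟩
    k * Δ (suc j) (λ t → (t × 1# + k) ^ r) + (suc j × 1#) * Δ j (λ t → (suc t × 1# + k) ^ r)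
      ≈⟨ +-cong (*-congˡ (Δ-pow-< (ℕP.m<n⇒m<1+n r<j) k)) (*-congˡ shifted) ⟩
    k * 0# + (suc j × 1#) * 0#                         ≈⟨ trans (+-cong (zeroʳ k) (zeroʳ _)) (+-identityʳ 0#) ⟩
    0#                                                 ∎
    where
    shifted : Δ j (λ t → (suc t × 1# + k) ^ r) ≈ 0#
    shifted = trans (Δ-cong j (λ t → ^-congˡ r (shift t k))) (Δ-pow-< r<j (1# + k))

  -- Falling factorials

  infix 8 _↓_
  _↓_ : Carrier → ℕ → Carrier
  x ↓ zero  = 1#
  x ↓ suc i = x ↓ i * (x - i × 1#)

  ↓-cong : ∀ i {x y} → x ≈ y → x ↓ i ≈ y ↓ i
  ↓-cong zero    x≈y = refl
  ↓-cong (suc i) x≈y = *-cong (↓-cong i x≈y) (+-congʳ x≈y)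

  ↓-shift : ∀ i x → (1# + x) ↓ suc i ≈ (1# + x) * x ↓ i
  ↓-shift zero    x = trans (*-identityˡ _) (trans (+-congˡ -0#≈0#) (trans (+-identityʳ _) (sym (*-identityʳ _))))
  ↓-shift (suc i) x = begin
    (1# + x) ↓ suc i * ((1# + x) - (1# + i × 1#))  ≈⟨ *-congʳ (↓-shift i x) ⟩
    ((1# + x) * x ↓ i) * ((1# + x) - (1# + i × 1#)) ≈⟨ solve 3 (λ x f n →
        ((con (+ 1) :+ x) :* f) :* ((con (+ 1) :+ x) :- (con (+ 1) :+ n))
        := (con (+ 1) :+ x) :* (f :* (x :- n))) refl x (x ↓ i) (i × 1#) ⟩
    (1# + x) * (x ↓ i * (x - i × 1#))              ∎

  ↓-suc : ∀ i x → (1# + x) ↓ suc i ≈ x ↓ suc i + (suc i × 1#) * x ↓ i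
  ↓-suc i x = trans (↓-shift i x) (solve 3 (λ x f n →
    (con (+ 1) :+ x) :* f := f :* (x :- n) :+ (con (+ 1) :+ n) :* f) refl x (x ↓ i) (i × 1#))

  0↓suc : ∀ i → 0# ↓ suc i ≈ 0#
  0↓suc zero    = trans (*-identityˡ _) (-‿inverseʳ 0#)
  0↓suc (suc i) = trans (*-congʳ (0↓suc i)) (zeroˡ _)

  ×1↓ : ∀ n d → (n × 1#) ↓ d ≈ ((d !) ℕ.* (n C d)) × 1#
  ×1↓ n       zero    = sym (+-identityʳ 1#)
  ×1↓ zero    (suc d) = trans (0↓suc d) (≡.subst (λ z → 0# ≈ z × 1#) (≡.sym (ℕP.*-zeroʳ (suc d !))) refl)
  ×1↓ (suc n) (suc d) = begin
    (1# + n × 1#) ↓ suc d                                  ≈⟨ ↓-suc d (n × 1#) ⟩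
    (n × 1#) ↓ suc d + (suc d × 1#) * (n × 1#) ↓ d         ≈⟨ +-cong (×1↓ n (suc d)) (*-congˡ (×1↓ n d)) ⟩
    (a × 1#) + (suc d × 1#) * (b × 1#)                     ≈⟨ +-congˡ (×1-homo-* (suc d) b) ⟨
    (a × 1#) + (suc d ℕ.* b) × 1#                          ≈⟨ ×-homo-+ 1# a (suc d ℕ.* b) ⟨
    (a ℕ.+ suc d ℕ.* b) × 1#                               ≡⟨ ≡.cong (_× 1#) (!*C-pascal n d) ⟩
    ((suc d !) ℕ.* (suc n C suc d)) × 1#                   ∎
    where
    a = (suc d !) ℕ.* (n C suc d)
    b = (d !) ℕ.* (n C d)

  -- Δ↓ j i m = i(i-1)⋯(i-j+1) · m↓(i-j)
  Δ↓ : ℕ → ℕ → Carrier → Carrier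
  Δ↓ zero    i       m = m ↓ i
  Δ↓ (suc j) zero    m = 0#
  Δ↓ (suc j) (suc i) m = (suc i × 1#) * Δ↓ j i m

  Δ-↓ : ∀ j i m → Δ j (λ t → (t × 1# + m) ↓ i) ≈ Δ↓ j i m
  Δ-↓ zero    i       m = trans (Δ-zero (λ t → (t × 1# + m) ↓ i)) (↓-cong i (+-identityˡ m))
  Δ-↓ (suc j) zero    m = Δ-const j 1#
  Δ-↓ (suc j) (suc i) m = begin
    Δ (suc j) (λ t → y t ↓ suc i)                                   ≈⟨ Δ-suc j _ ⟩
    Δ j (λ t → y (suc t) ↓ suc i) - Δ j (λ t → y t ↓ suc i)         ≈⟨ +-congʳ (Δ-cong j step) ⟩
    Δ j (λ t → y t ↓ suc i + n * y t ↓ i) - Δ j (λ t → y t ↓ suc i) ≈⟨ +-congʳ (Δ-+ j _ _) ⟩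
    (Δ j (λ t → y t ↓ suc i) + Δ j (λ t → n * y t ↓ i)) - Δ j (λ t → y t ↓ suc i)
      ≈⟨ solve 2 (λ a b → (a :+ b) :- a := b) refl _ _ ⟩
    Δ j (λ t → n * y t ↓ i)                                         ≈⟨ Δ-*ˡ j n _ ⟩
    n * Δ j (λ t → y t ↓ i)                                         ≈⟨ *-congˡ (Δ-↓ j i m) ⟩
    n * Δ↓ j i m                                                    ∎
    where
    y = λ t → t × 1# + m
    n = suc i × 1#
    step : ∀ t → y (suc t) ↓ suc i ≈ y t ↓ suc i + n * y t ↓ i
    step t = trans (↓-cong (suc i) (+-assoc 1# (t × 1#) m)) (↓-suc i (y t))

  Δ↓-cong : ∀ j i {m m′} → m ≈ m′ → Δ↓ j i m ≈ Δ↓ j i m′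
  Δ↓-cong zero    i       m≈m′ = ↓-cong i m≈m′
  Δ↓-cong (suc j) zero    m≈m′ = refl
  Δ↓-cong (suc j) (suc i) m≈m′ = *-congˡ (Δ↓-cong j i m≈m′)

  δ-≡⊎≈0 : ∀ i j → i ≡ j ⊎ δ i j ≈ 0#
  δ-≡⊎≈0 zero    zero    = inj₁ ≡.refl
  δ-≡⊎≈0 zero    (suc j) = inj₂ refl
  δ-≡⊎≈0 (suc i) zero    = inj₂ refl
  δ-≡⊎≈0 (suc i) (suc j) with δ-≡⊎≈0 i j
  ... | inj₁ i≡j  = inj₁ (≡.cong suc i≡j)
  ... | inj₂ δ≈0 = inj₂ δ≈0

  Δ↓-0 : ∀ j i → Δ↓ j i 0# ≈ natR (j !) * δ i j
  Δ↓-0 zero    zero    = sym (trans (*-identityʳ _) (+-identityʳ 1#))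
  Δ↓-0 zero    (suc i) = trans (0↓suc i) (sym (zeroʳ _))
  Δ↓-0 (suc j) zero    = sym (zeroʳ _)
  Δ↓-0 (suc j) (suc i) with δ-≡⊎≈0 i j
  ... | inj₁ ≡.refl = begin
    (suc i × 1#) * Δ↓ i i 0#                     ≈⟨ *-congˡ (Δ↓-0 i i) ⟩
    (suc i × 1#) * (((i !) × 1#) * δ i i)        ≈⟨ *-assoc _ _ _ ⟨
    ((suc i × 1#) * ((i !) × 1#)) * δ i i        ≈⟨ *-congʳ (×1-homo-* (suc i) (i !)) ⟨
    ((suc i !) × 1#) * δ i i                     ∎
  ... | inj₂ δ≈0 = begin
    (suc i × 1#) * Δ↓ j i 0#          ≈⟨ *-congˡ (trans (Δ↓-0 j i) (trans (*-congˡ δ≈0) (zeroʳ _))) ⟩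
    (suc i × 1#) * 0#                 ≈⟨ zeroʳ _ ⟩
    0#                                ≈⟨ trans (*-congˡ δ≈0) (zeroʳ _) ⟨
    ((suc j !) × 1#) * δ i j          ∎

  Δ↓-×1 : ∀ {j i} n → j ≤ i → Δ↓ j i (n × 1#) ≈ ((i !) ℕ.* (n C (i ∸ j))) × 1#
  Δ↓-×1 {zero}  {i}     n _         = ×1↓ n i
  Δ↓-×1 {suc j} {suc i} n (s≤s j≤i) = begin
    (suc i × 1#) * Δ↓ j i (n × 1#)                          ≈⟨ *-congˡ (Δ↓-×1 n j≤i) ⟩
    (suc i × 1#) * (((i !) ℕ.* (n C (i ∸ j))) × 1#)         ≈⟨ ×1-homo-* (suc i) ((i !) ℕ.* (n C (i ∸ j))) ⟨
    (suc i ℕ.* ((i !) ℕ.* (n C (i ∸ j)))) × 1#              ≡⟨ ≡.cong (_× 1#) (ℕP.*-assoc (suc i) (i !) _) ⟨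
    ((suc i !) ℕ.* (n C (i ∸ j))) × 1#                      ∎

  Δ↓-> : ∀ {j i} m → i < j → Δ↓ j i m ≈ 0#
  Δ↓-> {suc j} {zero}  m _         = refl
  Δ↓-> {suc j} {suc i} m (s≤s i<j) = trans (*-congˡ (Δ↓-> m i<j)) (zeroʳ _)

  -- Stirling numbers and the convolution

  stirling1-vanish : ∀ {i r} → i < r → stirling1 i r ≈ 0#
  stirling1-vanish {zero}  {suc r} _         = refl
  stirling1-vanish {suc i} {suc r} (s≤s i<r) = begin
    stirling1 i r - (i × 1#) * stirling1 i (suc r)
      ≈⟨ +-cong (stirling1-vanish i<r) (-‿cong (*-congˡ (stirling1-vanish (ℕP.m<n⇒m<1+n i<r)))) ⟩
    0# - (i × 1#) * 0#  ≈⟨ +-congˡ (-‿cong (zeroʳ _)) ⟩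
    0# - 0#             ≈⟨ -‿inverseʳ 0# ⟩
    0#                  ∎

  stirling1-expansion : ∀ i x → sumN (suc i) (λ r → stirling1 i r * x ^ r) ≈ x ↓ i
  stirling1-expansion zero    x = trans (+-identityˡ _) (*-identityˡ 1#)
  stirling1-expansion (suc i) x = begin
    sumN (suc (suc i)) (λ r → stirling1 (suc i) r * x ^ r)                ≈⟨ sumN-suc (suc i) _ ⟩
    (- n * s₀) * 1# + sumN (suc i) (λ r → (stirling1 i r - n * stirling1 i (suc r)) * (x * x ^ r))
        ≈⟨ +-congˡ (sumN-cong (suc i) split) ⟩
    (- n * s₀) * 1# + sumN (suc i) (λ r → x * S r + (- n) * S (suc r))    ≈⟨ +-congˡ (sumN-+ (suc i) _ _) ⟩
    (- n * s₀) * 1# + (sumN (suc i) (λ r → x * S r) + sumN (suc i) (λ r → (- n) * S (suc r)))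
        ≈⟨ +-congˡ (+-cong (sumN-*ˡ (suc i) x S) (sumN-*ˡ (suc i) (- n) (S ∘ suc))) ⟨
    (- n * s₀) * 1# + (x * ΣS + (- n) * ΣS∘suc)
        ≈⟨ +-congˡ (+-congˡ (*-congˡ ΣS∘suc≈)) ⟩
    (- n * s₀) * 1# + (x * ΣS + (- n) * (ΣS - s₀ * 1#))                   ≈⟨ solve 4 (λ n s₀ x ΣS →
        ((:- n) :* s₀) :* con (+ 1) :+ (x :* ΣS :+ (:- n) :* (ΣS :- s₀ :* con (+ 1))) := ΣS :* (x :- n))
        refl n s₀ x ΣS ⟩
    ΣS * (x - n)                                                          ≈⟨ *-congʳ (stirling1-expansion i x) ⟩
    x ↓ i * (x - n)                                                       ∎
    where
    n = i × 1#
    s₀ = stirling1 i 0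
    S : ℕ → Carrier
    S r = stirling1 i r * x ^ r
    ΣS = sumN (suc i) S
    ΣS∘suc = sumN (suc i) (S ∘ suc)
    split : ∀ r → (stirling1 i r - n * stirling1 i (suc r)) * (x * x ^ r) ≈ x * S r + (- n) * S (suc r)
    split r = solve 5 (λ a b n x p → (a :- n :* b) :* (x :* p) := x :* (a :* p) :+ (:- n) :* (b :* (x :* p)))
      refl (stirling1 i r) (stirling1 i (suc r)) n x (x ^ r)
    ΣS∘suc≈ : ΣS∘suc ≈ ΣS - s₀ * 1#
    ΣS∘suc≈ = sym (begin
      ΣS - s₀ * 1#
        ≈⟨ +-congʳ (sumN-extend S (ℕP.n≤1+n (suc i)) (λ t i<t → trans (*-congʳ (stirling1-vanish i<t)) (zeroˡ _))) ⟨
      sumN (suc (suc i)) S - s₀ * 1# ≈⟨ +-congʳ (sumN-suc (suc i) S) ⟩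
      (s₀ * 1# + ΣS∘suc) - s₀ * 1#   ≈⟨ solve 2 (λ a b → (a :+ b) :- a := b) refl (s₀ * 1#) ΣS∘suc ⟩
      ΣS∘suc                         ∎)

  cc-expansion : ∀ i k y → sumN (suc i) (λ r → cc i r k * y ^ r) ≈ (y - k) ↓ i
  cc-expansion i k y = begin
    sumN (suc i) (λ r → cc i r k * y ^ r)              ≈⟨ sumN-cong (suc i) (λ r →
                                                            trans (*-congʳ (sumFT≈sumN r i _ (λ q q<r → C>⇒×≈0 _ q<r)))
                                                                  (sumN-*ʳ (suc i) (y ^ r) _)) ⟩
    sumN (suc i) (λ r → sumN (suc i) (λ q → V r q))    ≈⟨ sumN-swap (suc i) (suc i) V ⟩
    sumN (suc i) (λ q → sumN (suc i) (λ r → V r q))    ≈⟨ sumN-cong-< (suc i) inner ⟩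
    sumN (suc i) (λ q → stirling1 i q * (y - k) ^ q)   ≈⟨ stirling1-expansion i (y - k) ⟩
    (y - k) ↓ i                                        ∎
    where
    V : ℕ → ℕ → Carrier
    V r q = ((q C r) × ((- k) ^ (q ∸ r) * stirling1 i q)) * y ^ r
    W : ℕ → ℕ → Carrier
    W q r = (q C r) × (y ^ r * (- k) ^ (q ∸ r))
    V≈sW : ∀ q r → V r q ≈ stirling1 i q * W q r
    V≈sW q r = begin
      ((q C r) × (a * s)) * b ≈⟨ *-congʳ (×≈×1* (q C r) _) ⟩
      (m * (a * s)) * b       ≈⟨ solve 4 (λ m a s b → (m :* (a :* s)) :* b := s :* (m :* (b :* a))) refl m a s b ⟩
      s * (m * (b * a))       ≈⟨ *-congˡ (×≈×1* (q C r) _) ⟨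
      s * W q r               ∎
      where
      a = (- k) ^ (q ∸ r)
      s = stirling1 i q
      b = y ^ r
      m = (q C r) × 1#
    inner : ∀ q → q < suc i → sumN (suc i) (λ r → V r q) ≈ stirling1 i q * (y - k) ^ q
    inner q q≤i = begin
      sumN (suc i) (λ r → V r q)                  ≈⟨ sumN-cong (suc i) (V≈sW q) ⟩
      sumN (suc i) (λ r → stirling1 i q * W q r)  ≈⟨ sumN-*ˡ (suc i) _ (W q) ⟨
      stirling1 i q * sumN (suc i) (W q)          ≈⟨ *-congˡ (sumN-extend (W q) q≤i (λ t q<t → C>⇒×≈0 _ q<t)) ⟩
      stirling1 i q * sumN (suc q) (W q)          ≈⟨ *-congˡ (binomial q y (- k)) ⟨
      stirling1 i q * (y - k) ^ q                 ∎

  convo≈Δ↓ : ∀ i j k₁ k₂ → convo i j k₁ k₂ ≈ Δ↓ j i (k₂ - k₁)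
  convo≈Δ↓ i j k₁ k₂ = begin
    convo i j k₁ k₂                                                 ≈⟨ sumFT≈sumN j i _ below-j ⟩
    sumN (suc i) (λ r → cc i r k₁ * Δ j (λ t → (t × 1# + k₂) ^ r))  ≈⟨ Δ-sum j (suc i) _ _ ⟩
    Δ j (λ t → sumN (suc i) (λ r → cc i r k₁ * (t × 1# + k₂) ^ r))  ≈⟨ Δ-cong j expand ⟩
    Δ j (λ t → (t × 1# + (k₂ - k₁)) ↓ i)                            ≈⟨ Δ-↓ j i (k₂ - k₁) ⟩
    Δ↓ j i (k₂ - k₁)                                                ∎
    where
    below-j : ∀ r → r < j → cc i r k₁ * bb r j k₂ ≈ 0#
    below-j r r<j = trans (*-congˡ (Δ-pow-< r<j k₂)) (zeroʳ _)
    expand : ∀ t → sumN (suc i) (λ r → cc i r k₁ * (t × 1# + k₂) ^ r) ≈ (t × 1# + (k₂ - k₁)) ↓ i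
    expand t = trans (cc-expansion i k₁ (t × 1# + k₂)) (↓-cong i (+-assoc _ _ _))

  convo-diagonal : ∀ i j k → convo i j k k ≈ natR (j !) * δ i j
  convo-diagonal i j k = trans (convo≈Δ↓ i j k k) (trans (Δ↓-cong j i (-‿inverseʳ k)) (Δ↓-0 j i))

open StirlingConvolution ℤP.+-*-commutativeRing using (Δ↓; convo≈Δ↓; Δ↓-×1; Δ↓->)
open import Algebra.Definitions.RawSemiring (Semiring.rawSemiring (CommutativeRing.semiring ℤP.+-*-commutativeRing))
  using () renaming (_×_ to _×ℤ_)
open ≡.≡-Reasoning

×ℤ1≡+ : ∀ n → n ×ℤ + 1 ≡ + n
×ℤ1≡+ zero    = ≡.refl
×ℤ1≡+ (suc n) = ≡.cong (ℤ._+_ (+ 1)) (×ℤ1≡+ n)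

chooseℤ-≥ : ∀ n {i j} → j ℕ.≤ i → chooseℤ n (+ i ℤ.- + j) ≡ + (n C (i ∸ j))
chooseℤ-≥ n {i} {j} j≤i = ≡.cong (chooseℤ n) (≡.trans (ℤP.m-n≡m⊖n i j) (ℤP.⊖-≥ j≤i))

chooseℤ-< : ∀ n {i j} → i ℕ.< j → chooseℤ n (+ i ℤ.- + j) ≡ + 0
chooseℤ-< n {i} {j} i<j = ≡.cong (chooseℤ n) (begin
  + i ℤ.- + j                  ≡⟨ ℤP.m-n≡m⊖n i j ⟩
  i ⊖ j                        ≡⟨ ℤP.⊖-< i<j ⟩
  ℤ.- (+ (j ∸ i))              ≡⟨ ≡.cong (λ d → ℤ.- (+ d)) j∸i≡suc ⟩
  -[1+ j ∸ suc i ]             ∎)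
  where
  j∸i≡suc : j ∸ i ≡ suc (j ∸ suc i)
  j∸i≡suc = ℕP.+-∸-assoc 1 i<j

Δ↓-×ℤ1 : ∀ i j n → Δ↓ j i (n ×ℤ + 1) ≡ + (i !) ℤ.* chooseℤ n (+ i ℤ.- + j)
Δ↓-×ℤ1 i j n with ℕP.≤-<-connex j i
... | inj₁ j≤i = begin
  Δ↓ j i (n ×ℤ + 1)                    ≡⟨ Δ↓-×1 n j≤i ⟩
  ((i !) ℕ.* (n C (i ∸ j))) ×ℤ + 1     ≡⟨ ×ℤ1≡+ _ ⟩
  + ((i !) ℕ.* (n C (i ∸ j)))          ≡⟨ ℤP.pos-* (i !) (n C (i ∸ j)) ⟩
  + (i !) ℤ.* + (n C (i ∸ j))          ≡⟨ ≡.cong (ℤ._*_ (+ (i !))) (chooseℤ-≥ n j≤i) ⟨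
  + (i !) ℤ.* chooseℤ n (+ i ℤ.- + j)  ∎
... | inj₂ i<j = begin
  Δ↓ j i (n ×ℤ + 1)                    ≡⟨ Δ↓-> _ i<j ⟩
  + 0                                  ≡⟨ ℤP.*-zeroʳ (+ (i !)) ⟨
  + (i !) ℤ.* + 0                      ≡⟨ ≡.cong (ℤ._*_ (+ (i !))) (chooseℤ-< n i<j) ⟨
  + (i !) ℤ.* chooseℤ n (+ i ℤ.- + j)  ∎

convo-ℤ : ∀ i j (k₁ k₂ : ℤ) → k₁ ℤ.≤ k₂ →
          GenZ.convo i j k₁ k₂ ≡ + (i !) ℤ.* chooseℤ ℤ.∣ k₂ ℤ.- k₁ ∣ (+ i ℤ.- + j)
convo-ℤ i j k₁ k₂ k₁≤k₂ = begin
  GenZ.convo i j k₁ k₂  ≡⟨ convo≈Δ↓ i j k₁ k₂ ⟩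
  Δ↓ j i (k₂ ℤ.- k₁)    ≡⟨ ≡.cong (Δ↓ j i) k₂-k₁≡n×1 ⟩
  Δ↓ j i (n ×ℤ + 1)     ≡⟨ Δ↓-×ℤ1 i j n ⟩
  + (i !) ℤ.* chooseℤ n (+ i ℤ.- + j) ∎
  where
  n = ℤ.∣ k₂ ℤ.- k₁ ∣
  k₂-k₁≡n×1 : k₂ ℤ.- k₁ ≡ n ×ℤ + 1
  k₂-k₁≡n×1 = ≡.trans (≡.sym (ℤP.0≤i⇒+∣i∣≡i (ℤP.i≤j⇒0≤j-i k₁≤k₂))) (≡.sym (×ℤ1≡+ n))

open import Data.Integer using (_-_; _*_; _≤_; ∣_∣)
open import Data.Product using (_×_; _,_)

theorem2p10 : ∀ {c ℓ} (i j : ℕ) →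
    ((R : CommutativeRing c ℓ) (k : CommutativeRing.Carrier R) →
      CommutativeRing._≈_ R (Gen.convo R i j k k)
        (CommutativeRing._*_ R (Gen.natR R (j !)) (Gen.δ R i j)))
    × ((k₁ k₂ : ℤ) → k₁ ≤ k₂ →
      GenZ.convo i j k₁ k₂ ≡ + (i !) * chooseℤ ∣ k₂ - k₁ ∣ (+ i - + j))
theorem2p10 i j = (λ R k → StirlingConvolution.convo-diagonal R i j k) , convo-ℤ i j
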